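{- Let $T$ be a tournament with $\vec{\omega}(T) = 2$. Then for any choices made in the construction of $\Pi(T)$ and $\prec^{\Pi}$, $\omega(\Pi(T)^{\prec^{\Pi}}) = 2$.
   Context: A tournament is an orientation of a complete graph. For a tournament $T$ and a total order $\prec$ of $V(T)$, the backedge graph $T^{\prec}$ is the undirected graph on $V(T)$ in which $a,b$ with $a \prec b$ are adjacent iff $ba \in A(T)$; $\vec{\omega}(T) = \min_{\prec}\omega(T^{\prec})$, and a $\vec{\omega}$-ordering is an order achieving this minimum. Construction of $\Pi(T)$ for a tournament $T$ on $n$ vertices: let $m = \binom{2n-1}{n}$ and take $2m+1$ disjoint copies $A_1,\dots,A_m,B,C_1,\dots,C_m$ of $T$. Fix a bijection $\varphi$ from $\{1,\dots,m\}$ to the set of $n$-element subsets of $\{1,\dots,2n-1\}$, and for each $j$ a bijection $\psi_j : V(T) \to \varphi(j)$; a vertex of $A_j$ or of $C_j$ that is the copy of $t \in V(T)$ receives label $\psi_j(t)$. Start from the tournament in which each copy induces $T$ and all arcs go from earlier to later copies in the sequence $A_1,\dots,A_m,B,C_1,\dots,C_m$; then reverse the arc from $a \in V(A_i)$ to $c \in V(C_j)$ exactly when $a$ and $c$ have the same label. The order $\prec^{\Pi}$ is the concatenation of arbitrary $\vec{\omega}$-orderings of $A_1$, then $A_2$, ..., $A_m$, then $B$, then $C_1,\dots,C_m$. -}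

module Defs where

open import Level using (0ℓ)
open import Data.Nat using (ℕ; _*_; _∸_; _<_; _≤_)
open import Data.Nat.Combinatorics using (_C_)
open import Data.Fin using (Fin; toℕ)
open import Data.Fin.Subset using (Subset; ∣_∣; _∈_)
open import Data.Product using (Σ; _×_; proj₁)
open import Data.Sum using (_⊎_)
open import Data.Empty using (⊥)
open import Relation.Nullary using (¬_)
open import Relation.Binary.PropositionalEquality using (_≡_; _≢_)
open import Relation.Binary.Structures using (IsStrictTotalOrder)
open import Function.Bundles using (_⤖_; Bijection)
open import Function.Definitions using (Injective)

record Tournament (n : ℕ) : Set₁ where
  field
    _⇒_     : Fin n → Fin n → Set
    irrefl  : ∀ a → ¬ (a ⇒ a)
    total   : ∀ a b → a ≢ b → (a ⇒ b) ⊎ (b ⇒ a)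
    antisym : ∀ a b → a ⇒ b → ¬ (b ⇒ a)

record TotalOrder (n : ℕ) : Set₁ where
  field
    _≺_ : Fin n → Fin n → Set
    isSTO : IsStrictTotalOrder _≡_ _≺_

HasClique : {V : Set} → (V → V → Set) → ℕ → Set
HasClique {V} E k =
  Σ (Fin k → V) λ f → Injective _≡_ _≡_ f × (∀ i j → i ≢ j → E (f i) (f j))

IsCliqueNumber : {V : Set} → (V → V → Set) → ℕ → Set
IsCliqueNumber E k = HasClique E k × (∀ l → HasClique E l → l ≤ k)

Backedge : {V : Set} → (V → V → Set) → (V → V → Set) → V → V → Set
Backedge arc _≺_ a b = (a ≺ b × arc b a) ⊎ (b ≺ a × arc a b)

TBackedge : ∀ {n} → Tournament n → TotalOrder n → Fin n → Fin n → Set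
TBackedge T O = Backedge (Tournament._⇒_ T) (TotalOrder._≺_ O)

IsOmegaArrow : ∀ {n} → Tournament n → ℕ → Set₁
IsOmegaArrow T k =
  Σ (TotalOrder _) (λ O → IsCliqueNumber (TBackedge T O) k) ×
  (∀ (O : TotalOrder _) c → IsCliqueNumber (TBackedge T O) c → k ≤ c)

IsOmegaOrdering : ∀ {n} → Tournament n → TotalOrder n → Set₁
IsOmegaOrdering T O = Σ ℕ λ k → IsOmegaArrow T k × IsCliqueNumber (TBackedge T O) k

mΠ : ℕ → ℕ
mΠ n = (2 * n ∸ 1) C n

-- n-element subsets of {1,…,2n-1} (represented as Fin (2n-1))
NSubset : ℕ → Set
NSubset n = Σ (Subset (2 * n ∸ 1)) λ p → ∣ p ∣ ≡ n

data Copy (m : ℕ) : Set where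
  A : Fin m → Copy m
  B : Copy m
  C : Fin m → Copy m

rank : ∀ {m} → Copy m → ℕ
rank (A i) = toℕ i
rank {m} B = m
rank {m} (C j) = m Data.Nat.+ 1 Data.Nat.+ toℕ j

-- all choices made in the construction of Π(T) and ≺^Π
record PiChoice {n : ℕ} (T : Tournament n) : Set₁ where
  field
    φ   : Fin (mΠ n) ⤖ NSubset n
    ψ   : (j : Fin (mΠ n)) →
          Fin n ⤖ Σ (Fin (2 * n ∸ 1)) (λ x → x ∈ proj₁ (Bijection.to φ j))
    ord   : Copy (mΠ n) → TotalOrder n
    ordOK : ∀ c → IsOmegaOrdering T (ord c)

module _ {n : ℕ} {T : Tournament n} (ch : PiChoice T) where
  open PiChoice ch

  -- label of the copy of t in A_j or C_j
  label : Fin (mΠ n) → Fin n → Fin (2 * n ∸ 1)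
  label j t = proj₁ (Bijection.to (ψ j) t)

  Reversed : Copy (mΠ n) → Fin n → Copy (mΠ n) → Fin n → Set
  Reversed (A i) u (C j) v = label i u ≡ label j v
  Reversed _ _ _ _ = ⊥

  PiV : Set
  PiV = Copy (mΠ n) × Fin n

  PiArc : PiV → PiV → Set
  PiArc (c Data.Product., u) (d Data.Product., v) =
    (c ≡ d × Tournament._⇒_ T u v)
    ⊎ (rank c < rank d × ¬ Reversed c u d v)
    ⊎ (rank d < rank c × Reversed d v c u)

  PiOrder : PiV → PiV → Set
  PiOrder (c Data.Product., u) (d Data.Product., v) =
    rank c < rank d ⊎ (c ≡ d × TotalOrder._≺_ (ord c) u v)

  PiBackedge : PiV → PiV → Set
  PiBackedge = Backedge PiArc PiOrder

-- Inside one copy the backedges are those of an ω⃗-ordering of T, so they contain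
-- no triangle.  Every other backedge of Π(T)^≺ joins a vertex of some A_i to the
-- vertex of some C_j with the same label, and the labels within one copy are
-- distinct; hence two vertices of one copy have no common neighbour in another,
-- a triangle cannot meet two copies, and ω(Π(T)^≺) ≤ 2.  The bound is attained
-- inside B.
module Submission where

open import Defs
open import Data.Nat using (ℕ; suc; _+_; _≤_; z≤n; s≤s)
open import Data.Nat.Properties using (<-irrefl; <-asym; ≤-antisym)
open import Data.Fin as Fin using (Fin)
open import Data.Fin.Patterns using (0F; 1F; 2F)
open import Data.Fin.Subset using (Subset; _∈_)
open import Data.Vec.Properties.WithK using ([]=-irrelevant)
open import Data.Product using (Σ; ∃; _×_; _,_; proj₁; proj₂)
open import Data.Sum using (inj₁; inj₂)
open import Data.Empty using (⊥-elim)
open import Relation.Nullary using (¬_; yes; no)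
open import Relation.Binary.Definitions using (Symmetric)
open import Relation.Binary.PropositionalEquality
open import Function.Base using (_∘_)
open import Function.Bundles using (Bijection)
open import Function.Definitions using (Injective)

private
  variable
    V W : Set
    E F : V → V → Set

Backedge-sym : {arc _≺_ : V → V → Set} → Symmetric (Backedge arc _≺_)
Backedge-sym (inj₁ ab) = inj₂ ab
Backedge-sym (inj₂ ba) = inj₁ ba

TBackedge-sym : ∀ {n} (T : Tournament n) (O : TotalOrder n) → Symmetric (TBackedge T O)
TBackedge-sym T O = Backedge-sym {arc = Tournament._⇒_ T} {_≺_ = TotalOrder._≺_ O}

HasClique-map : (f : V → W) → Injective _≡_ _≡_ f → (∀ {x y} → E x y → F (f x) (f y)) →
                ∀ {k} → HasClique E k → HasClique F k
HasClique-map f f-inj f-hom (g , g-inj , g-clique) =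
  f ∘ g , (λ e → g-inj (f-inj e)) , λ i j i≢j → f-hom (g-clique i j i≢j)

pairwiseDistinct⇒injective : ∀ {k} {f : Fin k → V} →
                             (∀ i j → i ≢ j → f i ≢ f j) → Injective _≡_ _≡_ f
pairwiseDistinct⇒injective distinct {i} {j} fi≡fj with i Fin.≟ j
... | yes i≡j = i≡j
... | no  i≢j = ⊥-elim (distinct i j i≢j fi≡fj)

IsTriangle : (V → V → Set) → V → V → V → Set
IsTriangle E x y z = (x ≢ y × x ≢ z × y ≢ z) × (E x y × E x z × E y z)

TriangleFree : (V → V → Set) → Set
TriangleFree E = ∀ x y z → ¬ IsTriangle E x y z

TriangleFree-⊆ : (∀ {x y} → E x y → F x y) → TriangleFree F → TriangleFree E
TriangleFree-⊆ E⊆F F-free x y z (distinct , exy , exz , eyz) =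
  F-free x y z (distinct , E⊆F exy , E⊆F exz , E⊆F eyz)

module _ (x y z : V) where

  triple : Fin 3 → V
  triple 0F = x
  triple 1F = y
  triple 2F = z

  triple-pairwise : {R : V → V → Set} → Symmetric R → R x y → R x z → R y z →
                    ∀ i j → i ≢ j → R (triple i) (triple j)
  triple-pairwise R-sym rxy rxz ryz 0F 1F _ = rxy
  triple-pairwise R-sym rxy rxz ryz 0F 2F _ = rxz
  triple-pairwise R-sym rxy rxz ryz 1F 0F _ = R-sym rxy
  triple-pairwise R-sym rxy rxz ryz 1F 2F _ = ryz
  triple-pairwise R-sym rxy rxz ryz 2F 0F _ = R-sym rxz
  triple-pairwise R-sym rxy rxz ryz 2F 1F _ = R-sym ryz
  triple-pairwise R-sym rxy rxz ryz 0F 0F i≢i = ⊥-elim (i≢i refl)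
  triple-pairwise R-sym rxy rxz ryz 1F 1F i≢i = ⊥-elim (i≢i refl)
  triple-pairwise R-sym rxy rxz ryz 2F 2F i≢i = ⊥-elim (i≢i refl)

triangle⇒HasClique3 : Symmetric E → ∀ {x y z} → IsTriangle E x y z → HasClique E 3
triangle⇒HasClique3 E-sym {x} {y} {z} ((x≢y , x≢z , y≢z) , exy , exz , eyz) =
  triple x y z ,
  pairwiseDistinct⇒injective (triple-pairwise x y z ≢-sym x≢y x≢z y≢z) ,
  triple-pairwise x y z E-sym exy exz eyz

HasClique⇒triangle : ∀ {l} → HasClique E (3 + l) → ∃ λ x → ∃ λ y → ∃ λ z → IsTriangle E x y z
HasClique⇒triangle (f , f-inj , f-clique) =
  f 0F , f 1F , f 2F ,
  ((λ e → 0≢1 (f-inj e)) , (λ e → 0≢2 (f-inj e)) , (λ e → 1≢2 (f-inj e))) ,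
  f-clique 0F 1F 0≢1 , f-clique 0F 2F 0≢2 , f-clique 1F 2F 1≢2
  where
  0≢1 : _≢_ {A = Fin _} 0F 1F
  0≢1 ()
  0≢2 : _≢_ {A = Fin _} 0F 2F
  0≢2 ()
  1≢2 : _≢_ {A = Fin _} 1F 2F
  1≢2 ()

triangleFree⇒clique≤2 : TriangleFree E → ∀ l → HasClique E l → l ≤ 2
triangleFree⇒clique≤2 E-free 0 _ = z≤n
triangleFree⇒clique≤2 E-free 1 _ = s≤s z≤n
triangleFree⇒clique≤2 E-free 2 _ = s≤s (s≤s z≤n)
triangleFree⇒clique≤2 E-free (suc (suc (suc l))) clique
  with x , y , z , triangle ← HasClique⇒triangle {l = l} clique = ⊥-elim (E-free x y z triangle)

cliqueNumber2⇒triangleFree : Symmetric E → IsCliqueNumber E 2 → TriangleFree E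
cliqueNumber2⇒triangleFree E-sym (_ , maximal) x y z triangle
  with s≤s (s≤s ()) ← maximal 3 (triangle⇒HasClique3 E-sym triangle)

ωOrdering-cliqueNumber : ∀ {n} (T : Tournament n) {k O} →
                         IsOmegaArrow T k → IsOmegaOrdering T O → IsCliqueNumber (TBackedge T O) k
ωOrdering-cliqueNumber T {k} {O} ((O₀ , ω₀) , minimal) (k′ , (_ , minimal′) , ω′) =
  subst (IsCliqueNumber (TBackedge T O)) k′≡k ω′
  where
  k′≡k : k′ ≡ k
  k′≡k = ≤-antisym (minimal′ O₀ _ ω₀) (minimal O k′ ω′)

module _ {n : ℕ} {T : Tournament n} (ch : PiChoice T) where
  open PiChoice ch

  label-injective : ∀ j → Injective _≡_ _≡_ (label ch j)
  label-injective j {u} {v} same-label = Bijection.injective (ψ j) (ψ-equal (ψ′ u) (ψ′ v) same-label)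
    where
    ψ′ = Bijection.to (ψ j)
    ψ-equal : ∀ {k} {p : Subset k} (a b : Σ (Fin k) (_∈ p)) → proj₁ a ≡ proj₁ b → a ≡ b
    ψ-equal (x , x∈p) (.x , x∈p′) refl = cong (x ,_) ([]=-irrelevant x∈p x∈p′)

  data Adjacent : PiV ch → PiV ch → Set where
    within : ∀ c {u v} → TBackedge T (ord c) u v → Adjacent (c , u) (c , v)
    A─C    : ∀ i j {u v} → label ch i u ≡ label ch j v → Adjacent (A i , u) (C j , v)
    C─A    : ∀ i j {u v} → label ch i u ≡ label ch j v → Adjacent (C j , v) (A i , u)

  Adjacent-sym : Symmetric Adjacent
  Adjacent-sym (within c b) = within c (TBackedge-sym T (ord c) b)
  Adjacent-sym (A─C i j e) = C─A i j e
  Adjacent-sym (C─A i j e) = A─C i j e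

  reversed⇒Adjacent : ∀ c u d v → Reversed ch c u d v → Adjacent (c , u) (d , v)
  reversed⇒Adjacent (A i) u (C j) v same-label = A─C i j same-label

  backarc⇒Adjacent : ∀ x y → PiOrder ch x y → PiArc ch y x → Adjacent x y
  backarc⇒Adjacent _ _ (inj₁ c<d) (inj₁ (refl , _))         = ⊥-elim (<-irrefl refl c<d)
  backarc⇒Adjacent _ _ (inj₁ c<d) (inj₂ (inj₁ (d<c , _)))   = ⊥-elim (<-asym c<d d<c)
  backarc⇒Adjacent (c , u) (d , v) (inj₁ _) (inj₂ (inj₂ (_ , rev))) = reversed⇒Adjacent c u d v rev
  backarc⇒Adjacent (c , _) _ (inj₂ (refl , u≺v)) (inj₁ (_ , v⇒u)) = within c (inj₁ (u≺v , v⇒u))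
  backarc⇒Adjacent _ _ (inj₂ (refl , _)) (inj₂ (inj₁ (c<c , _))) = ⊥-elim (<-irrefl refl c<c)
  backarc⇒Adjacent _ _ (inj₂ (refl , _)) (inj₂ (inj₂ (c<c , _))) = ⊥-elim (<-irrefl refl c<c)

  backedge⇒Adjacent : ∀ {x y} → PiBackedge ch x y → Adjacent x y
  backedge⇒Adjacent {x} {y} (inj₁ (x≺y , y→x)) = backarc⇒Adjacent x y x≺y y→x
  backedge⇒Adjacent {x} {y} (inj₂ (y≺x , x→y)) = Adjacent-sym (backarc⇒Adjacent y x y≺x x→y)

  within-backedge : ∀ c {u v} → TBackedge T (ord c) u v → PiBackedge ch (c , u) (c , v)
  within-backedge c (inj₁ (u≺v , v⇒u)) = inj₁ (inj₂ (refl , u≺v) , inj₁ (refl , v⇒u))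
  within-backedge c (inj₂ (v≺u , u⇒v)) = inj₂ (inj₂ (refl , v≺u) , inj₁ (refl , u⇒v))

  Adjacent-triangleFree : (∀ c → TriangleFree (TBackedge T (ord c))) → TriangleFree Adjacent
  Adjacent-triangleFree copy-free _ _ _ ((x≢y , x≢z , y≢z) , within c bxy , within _ bxz , within _ byz) =
    copy-free c _ _ _ ((≢-within x≢y , ≢-within x≢z , ≢-within y≢z) , bxy , bxz , byz)
    where
    ≢-within : ∀ {u v} → (c , u) ≢ (c , v) → u ≢ v
    ≢-within cu≢cv = cu≢cv ∘ cong (c ,_)
  Adjacent-triangleFree _ _ _ _ ((x≢y , _) , within (A i) _ , A─C _ _ exz , A─C _ _ eyz) =
    x≢y (cong (A i ,_) (label-injective i (trans exz (sym eyz))))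
  Adjacent-triangleFree _ _ _ _ ((x≢y , _) , within (C j) _ , C─A _ _ exz , C─A _ _ eyz) =
    x≢y (cong (C j ,_) (label-injective j (trans (sym exz) eyz)))
  Adjacent-triangleFree _ _ _ _ ((_ , x≢z , _) , A─C i _ exy , within _ _ , C─A _ _ eyz) =
    x≢z (cong (A i ,_) (label-injective i (trans exy (sym eyz))))
  Adjacent-triangleFree _ _ _ _ ((_ , _ , y≢z) , A─C _ j exy , A─C _ _ exz , within _ _) =
    y≢z (cong (C j ,_) (label-injective j (trans (sym exy) exz)))
  Adjacent-triangleFree _ _ _ _ ((_ , x≢z , _) , C─A _ j exy , within _ _ , A─C _ _ eyz) =
    x≢z (cong (C j ,_) (label-injective j (trans (sym exy) eyz)))
  Adjacent-triangleFree _ _ _ _ ((_ , _ , y≢z) , C─A i _ exy , C─A _ _ exz , within _ _) =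
    y≢z (cong (A i ,_) (label-injective i (trans exy (sym exz))))

lemma4p4 : (n : ℕ) (T : Tournament n) → IsOmegaArrow T 2 →
    (ch : PiChoice T) → IsCliqueNumber (PiBackedge ch) 2
lemma4p4 n T ω⃗T≡2 ch = clique-in-B , triangleFree⇒clique≤2 Π-triangleFree
  where
  open PiChoice ch

  copy-cliqueNumber : ∀ c → IsCliqueNumber (TBackedge T (ord c)) 2
  copy-cliqueNumber c = ωOrdering-cliqueNumber T {O = ord c} ω⃗T≡2 (ordOK c)

  clique-in-B : HasClique (PiBackedge ch) 2
  clique-in-B = HasClique-map {F = PiBackedge ch} (B ,_) (cong proj₂) (within-backedge ch B)
                              (proj₁ (copy-cliqueNumber B))

  Π-triangleFree : TriangleFree (PiBackedge ch)
  Π-triangleFree = TriangleFree-⊆ (backedge⇒Adjacent ch) (Adjacent-triangleFree ch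
    λ c → cliqueNumber2⇒triangleFree (TBackedge-sym T (ord c)) (copy-cliqueNumber c))
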